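{- Let $\beta>1$ be the root of $x^2-ax-1$ with $a$ a positive integer, and $\alpha=-\beta^{ -1}$. Let $q\in\mathbb{Q}\cap(-1,1)$ and run the following algorithm. Start with $s^{(0)}_0=q$ and $s^{(0)}_j=0$ for $j\ge1$. For $i=0,1,2,\dots$, obtain $s^{(i+1)}$ from $s^{(i)}$ by setting $\delta=\lceil s^{(i)}_i\rceil-s^{(i)}_i$ and $s^{(i+1)}_i=\lceil s^{(i)}_i\rceil$, $s^{(i+1)}_{i+1}=s^{(i)}_{i+1}+a\delta$, $s^{(i+1)}_{i+2}=s^{(i)}_{i+2}-\delta$, and $s^{(i+1)}_j=s^{(i)}_j$ for all other $j$. Define the output sequence $s=(s_i)_{i\ge0}$ by $s_i=s^{(i+1)}_i$ (this digit is never modified afterwards). Then $s$ is an $\alpha$-adic representation of $q$ which is eventually periodic: $s_i\in\{0,1,\dots,a\}$ for all $i$, $\sum_{i\ge0}s_i\alpha^i=q$, and there is $p\ge1$ with $s_{i+p}=s_i$ for all sufficiently large $i$.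
   Context: An $\alpha$-adic representation of a number $z$ is a left-infinite integer digit sequence $(x_i)_{i\ge -k}$ with $z=\sum_{i\ge -k}x_i\alpha^i$; no admissibility condition is required. -}

module Defs where

open import Data.Nat as ℕ using (ℕ; zero; suc; _≡ᵇ_)
open import Data.Integer as ℤ using (ℤ; +_)
open import Data.Rational using (ℚ; _+_; _*_; _-_; -_; _/_; _<_; _≤_; 0ℚ; 1ℚ; ½; ceiling)
open import Data.Bool using (if_then_else_)
open import Data.Product using (_×_; Σ)
open import Data.Sum using (_⊎_)

ℚof : ℕ → ℚ
ℚof n = + n / 1

step : (a : ℕ) → (i : ℕ) → (ℕ → ℚ) → (ℕ → ℚ)
step a i f j =
  if j ≡ᵇ i then c
  else if j ≡ᵇ suc i then f j + ℚof a * δ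
  else if j ≡ᵇ suc (suc i) then f j - δ
  else f j
  where
  c : ℚ
  c = ceiling (f i) / 1
  δ : ℚ
  δ = c - f i

state : (a : ℕ) → (q : ℚ) → ℕ → (ℕ → ℚ)
state a q zero j = if j ≡ᵇ 0 then q else 0ℚ
state a q (suc i) = step a i (state a q i)

output : (a : ℕ) → (q : ℚ) → ℕ → ℚ
output a q i = state a q (suc i) i

-- Exact arithmetic in ℚ(α), where α = -β⁻¹ is the root (a - √(a²+4))/2
-- of x² - a x - 1 (so α² = a α + 1).  An element u + v α is a pair (u , v).

record ℚα : Set where
  constructor _+_α
  field
    re : ℚ
    im : ℚ
open ℚα public

embed : ℚ → ℚα
embed r = r + 0ℚ α

αₐ : ℚα
αₐ = 0ℚ + 1ℚ α

addα : ℚα → ℚα → ℚα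
addα (u + v α) (u' + v' α) = (u + u') + (v + v') α

-- (u + vα)(u' + v'α) = uu' + vv' + (uv' + vu' + a vv') α   using α² = aα + 1
mulα : (a : ℕ) → ℚα → ℚα → ℚα
mulα a (u + v α) (u' + v' α) = (u * u' + v * v') + (u * v' + v * u' + ℚof a * (v * v')) α

powα : (a : ℕ) → ℚα → ℕ → ℚα
powα a z zero = embed 1ℚ
powα a z (suc n) = mulα a (powα a z n) z

subα : ℚα → ℚα → ℚα
subα (u + v α) (u' + v' α) = (u - u') + (v - v') α

partialSum : (a : ℕ) → (ℕ → ℚ) → ℕ → ℚα
partialSum a s zero = embed 0ℚ
partialSum a s (suc n) = addα (partialSum a s n) (mulα a (embed (s n)) (powα a αₐ n))

-- Real order.  With D = a² + 4 and α = a/2 - (1/2)√D, the element u + vα equals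
-- x + y √D with x = u + (a/2) v, y = -(1/2) v.  Positivity of x + y√D (x, y ∈ ℚ, D > 0):
PosSqrt : ℚ → ℚ → ℚ → Set
PosSqrt D x y =
  (0ℚ ≤ x × 0ℚ ≤ y × (0ℚ < x ⊎ 0ℚ < y))
  ⊎ (0ℚ < x × y < 0ℚ × y * y * D < x * x)
  ⊎ (x < 0ℚ × 0ℚ < y × x * x < y * y * D)

Posα : (a : ℕ) → ℚα → Set
Posα a (u + v α) = PosSqrt (ℚof a * ℚof a + ℚof 4) (u + ½ * ℚof a * v) (- (½ * v))

AbsLt : (a : ℕ) → ℚα → ℚ → Set
AbsLt a z ε = Posα a (subα (embed ε) z) × Posα a (addα (embed ε) z)

SeriesConvergesTo : (a : ℕ) → (ℕ → ℚ) → ℚ → Set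
SeriesConvergesTo a s q =
  (ε : ℚ) → 0ℚ < ε → Σ ℕ (λ N → (n : ℕ) → N ℕ.≤ n → AbsLt a (subα (partialSum a s n) (embed q)) ε)

-- Only two entries of the state are ever live: after n steps the entries below n are final
-- digits and those beyond n + 1 are still 0, while the window (xₙ , yₙ) = (s⁽ⁿ⁾ₙ , s⁽ⁿ⁾ₙ₊₁)
-- moves by (x , y) ↦ (y + a δ , - δ) with δ = ⌈x⌉ - x ∈ [0, 1).  Hence -1 < xₙ < a and
-- -1 < yₙ ≤ 0, so every digit ⌈xₙ⌉ lies in {0, …, a}.  Both coordinates stay in (1/D)ℤ for
-- D the denominator of q, so the window ranges over a finite set and its orbit is eventually
-- periodic.
--
-- In ℚ(α) the algorithm keeps q = Sₙ + (xₙ + yₙ α) αⁿ, where Sₙ = Σ_{i<n} sᵢ αⁱ, which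
-- rewrites as Sₘ₊₂ - q = (δₘ₊₁ + δₘ α) αᵐ⁺¹.  Since αⁿ is a unit, the norm of this
-- remainder z is at most a + 1 in absolute value, whereas its trace grows like (δₘ₊₁ + δₘ) m,
-- which is at least m / D unless z = 0.  As z z′ = N z for the conjugate z′, z tends to 0.

module Submission where

open import Data.Bool.Base using (true; false)
open import Data.Fin.Base using (Fin; toℕ; fromℕ<; combine)
import Data.Fin.Properties as Fin
open import Data.Integer.Base as ℤ using (ℤ; +_; -[1+_])
open import Data.Nat.Base as ℕ using (ℕ; zero; suc; _≡ᵇ_; s≤s; z≤n)
import Data.Nat.Properties as ℕ
open import Data.Product.Base using (Σ; _×_; _,_; proj₁; proj₂)
open import Data.Rational.Base as ℚ using (ℚ; _/_; -_; 0ℚ; 1ℚ)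
open import Function.Base using (_∘_)
open import Relation.Binary.PropositionalEquality
open import Defs

EventuallyPeriodic : {A : Set} → (ℕ → A) → Set
EventuallyPeriodic f = Σ ℕ λ p → 1 ℕ.≤ p × Σ ℕ λ M → ∀ i → M ℕ.≤ i → f (i ℕ.+ p) ≡ f i

eventuallyPeriodic-map : ∀ {A B : Set} {f : ℕ → A} {h : ℕ → B} (g : A → B) →
                         (∀ n → h n ≡ g (f n)) → EventuallyPeriodic f → EventuallyPeriodic h
eventuallyPeriodic-map g h≡g∘f (p , 1≤p , M , periodic) =
  p , 1≤p , M , λ i M≤i → trans (h≡g∘f (i ℕ.+ p)) (trans (cong g (periodic i M≤i)) (sym (h≡g∘f i)))

module _ {S : Set} (F : S → S) (x : ℕ → S) (x-suc : ∀ n → x (suc n) ≡ F (x n)) where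
  open ≡-Reasoning

  orbit-shift : ∀ {i j} → x i ≡ x j → ∀ k → x (k ℕ.+ i) ≡ x (k ℕ.+ j)
  orbit-shift xᵢ≡xⱼ zero = xᵢ≡xⱼ
  orbit-shift {i} {j} xᵢ≡xⱼ (suc k) = begin
    x (suc k ℕ.+ i)  ≡⟨ x-suc (k ℕ.+ i) ⟩
    F (x (k ℕ.+ i))  ≡⟨ cong F (orbit-shift xᵢ≡xⱼ k) ⟩
    F (x (k ℕ.+ j))  ≡⟨ x-suc (k ℕ.+ j) ⟨
    x (suc k ℕ.+ j)  ∎

  repeat⇒eventuallyPeriodic : ∀ {i j} → i ℕ.< j → x i ≡ x j → EventuallyPeriodic x
  repeat⇒eventuallyPeriodic {i} {j} i<j xᵢ≡xⱼ = j ℕ.∸ i , ℕ.m<n⇒0<n∸m i<j , i , periodic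
    where
    periodic : ∀ m → i ℕ.≤ m → x (m ℕ.+ (j ℕ.∸ i)) ≡ x m
    periodic m i≤m = begin
      x (m ℕ.+ (j ℕ.∸ i))  ≡⟨ cong x (trans (sym (ℕ.+-∸-assoc m (ℕ.<⇒≤ i<j))) (ℕ.+-∸-comm j i≤m)) ⟩
      x (m ℕ.∸ i ℕ.+ j)    ≡⟨ orbit-shift xᵢ≡xⱼ (m ℕ.∸ i) ⟨
      x (m ℕ.∸ i ℕ.+ i)    ≡⟨ cong x (ℕ.m∸n+n≡m i≤m) ⟩
      x m                  ∎

  finite⇒eventuallyPeriodic : ∀ {B} (code : ℕ → Fin B) →
                              (∀ {i j} → code i ≡ code j → x i ≡ x j) → EventuallyPeriodic x
  finite⇒eventuallyPeriodic {B} code code-injective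
    with i , j , i<j , same ← Fin.pigeonhole (ℕ.n<1+n B) (code ∘ toℕ)
    = repeat⇒eventuallyPeriodic i<j (code-injective same)

-- ℚ's arithmetic and order are opened only inside this module, so that the theorem at the end
-- is stated with ℕ's _+_ and _≤_.
module _ where
  import Data.Integer.DivMod as ℤ
  import Data.Integer.Properties as ℤ
  open import Data.List.Base using (_∷_; [])
  open import Data.Nat.Coprimality using (1-coprimeTo) renaming (sym to coprime-sym)
  open import Data.Rational.Base using (mkℚ; _+_; _*_; _-_; _≤_; _<_; ½; floor; ceiling; ↧ₙ_)
  import Data.Rational.Properties as ℚ
  open import Algebra.Properties.Group ℚ.+-0-group using () renaming (∙-cancelʳ to +-cancelʳ)
  import Data.Rational.Unnormalised.Base as ℚᵘ
  import Data.Rational.Unnormalised.Properties as ℚᵘ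
  open import Data.Sum.Base using (_⊎_; inj₁; inj₂)
  open import Level using (0ℓ)
  open import Relation.Nullary.Decidable using (Dec; dec⇒maybe; yes; no)
  open import Tactic.RingSolver using (solve-∀; solve)
  open import Tactic.RingSolver.Core.AlmostCommutativeRing using (AlmostCommutativeRing; fromCommutativeRing)
  open ℚ.≤-Reasoning

  ℚ-ring : AlmostCommutativeRing 0ℓ 0ℓ
  ℚ-ring = fromCommutativeRing ℚ.+-*-commutativeRing (λ x → dec⇒maybe (0ℚ ℚ.≟ x))

  p≤q⇒0≤q-p : ∀ {p q} → p ≤ q → 0ℚ ≤ q - p
  p≤q⇒0≤q-p {p} {q} p≤q = begin
    0ℚ     ≡⟨ ℚ.+-inverseʳ p ⟨
    p - p  ≤⟨ ℚ.+-monoˡ-≤ (- p) p≤q ⟩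
    q - p  ∎

  p<q⇒0<q-p : ∀ {p q} → p < q → 0ℚ < q - p
  p<q⇒0<q-p {p} {q} p<q = begin-strict
    0ℚ     ≡⟨ ℚ.+-inverseʳ p ⟨
    p - p  <⟨ ℚ.+-monoˡ-< (- p) p<q ⟩
    q - p  ∎

  0≤q-p⇒p≤q : ∀ {p q} → 0ℚ ≤ q - p → p ≤ q
  0≤q-p⇒p≤q {p} {q} 0≤q-p = begin
    p          ≡⟨ ℚ.+-identityˡ p ⟨
    0ℚ + p     ≤⟨ ℚ.+-monoˡ-≤ p 0≤q-p ⟩
    q - p + p  ≡⟨ solve (p ∷ q ∷ []) ℚ-ring ⟩
    q          ∎

  0<q-p⇒p<q : ∀ {p q} → 0ℚ < q - p → p < q
  0<q-p⇒p<q {p} {q} 0<q-p = begin-strict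
    p          ≡⟨ ℚ.+-identityˡ p ⟨
    0ℚ + p     <⟨ ℚ.+-monoˡ-< p 0<q-p ⟩
    q - p + p  ≡⟨ solve (p ∷ q ∷ []) ℚ-ring ⟩
    q          ∎

  *-nonNeg : ∀ {p q} → 0ℚ ≤ p → 0ℚ ≤ q → 0ℚ ≤ p * q
  *-nonNeg {p} {q} 0≤p 0≤q =
    ℚ.nonNegative⁻¹ (p * q) {{ℚ.nonNeg*nonNeg⇒nonNeg p {{ℚ.nonNegative 0≤p}} q {{ℚ.nonNegative 0≤q}}}}

  *-pos : ∀ {p q} → 0ℚ < p → 0ℚ < q → 0ℚ < p * q
  *-pos {p} {q} 0<p 0<q = ℚ.positive⁻¹ (p * q) {{ℚ.pos*pos⇒pos p {{ℚ.positive 0<p}} q {{ℚ.positive 0<q}}}}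

  *-monoˡ-≤-0≤ : ∀ {r p q} → 0ℚ ≤ r → p ≤ q → r * p ≤ r * q
  *-monoˡ-≤-0≤ {r} 0≤r = ℚ.*-monoˡ-≤-nonNeg r {{ℚ.nonNegative 0≤r}}

  *-cancelʳ-≡-pos : ∀ {p q} r → 0ℚ < r → p * r ≡ q * r → p ≡ q
  *-cancelʳ-≡-pos r 0<r pr≡qr = ℚ.≤-antisym (cancel pr≡qr) (cancel (sym pr≡qr))
    where
    cancel : ∀ {p q} → p * r ≡ q * r → p ≤ q
    cancel eq = ℚ.*-cancelʳ-≤-pos r {{ℚ.positive 0<r}} (ℚ.≤-reflexive eq)

  nonNeg-+≡0 : ∀ {p q} → 0ℚ ≤ p → 0ℚ ≤ q → p + q ≡ 0ℚ → p ≡ 0ℚ × q ≡ 0ℚ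
  nonNeg-+≡0 {p} {q} 0≤p 0≤q p+q≡0 = ℚ.≤-antisym p≤0 0≤p , ℚ.≤-antisym q≤0 0≤q
    where
    p≤0 = begin p ≡⟨ ℚ.+-identityʳ p ⟨ p + 0ℚ ≤⟨ ℚ.+-monoʳ-≤ p 0≤q ⟩ p + q ≡⟨ p+q≡0 ⟩ 0ℚ ∎
    q≤0 = begin q ≡⟨ ℚ.+-identityˡ q ⟨ 0ℚ + q ≤⟨ ℚ.+-monoˡ-≤ q 0≤p ⟩ p + q ≡⟨ p+q≡0 ⟩ 0ℚ ∎

  fromℤ : ℤ → ℚ
  fromℤ i = i / 1

  fromℤ≡mkℚ : ∀ i → fromℤ i ≡ mkℚ i 0 (coprime-sym (1-coprimeTo ℤ.∣ i ∣))
  fromℤ≡mkℚ i = ℚ.↥p/↧p≡p (mkℚ i 0 (coprime-sym (1-coprimeTo ℤ.∣ i ∣)))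

  fromℤ-+ : ∀ i j → fromℤ (i ℤ.+ j) ≡ fromℤ i + fromℤ j
  fromℤ-+ i j rewrite fromℤ≡mkℚ i | fromℤ≡mkℚ j =
    cong₂ (λ u v → (u ℤ.+ v) / 1) (sym (ℤ.*-identityʳ i)) (sym (ℤ.*-identityʳ j))

  fromℤ-* : ∀ i j → fromℤ (i ℤ.* j) ≡ fromℤ i * fromℤ j
  fromℤ-* i j rewrite fromℤ≡mkℚ i | fromℤ≡mkℚ j = refl

  fromℤ-neg : ∀ i → fromℤ (ℤ.- i) ≡ - fromℤ i
  fromℤ-neg i rewrite fromℤ≡mkℚ i | fromℤ≡mkℚ (ℤ.- i) with i
  ... | + zero     = refl
  ... | ℤ.+[1+ n ] = refl
  ... | -[1+ n ]   = refl

  fromℤ-mono-≤ : ∀ {i j} → i ℤ.≤ j → fromℤ i ≤ fromℤ j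
  fromℤ-mono-≤ {i} {j} i≤j rewrite fromℤ≡mkℚ i | fromℤ≡mkℚ j =
    ℚ.*≤* (subst₂ ℤ._≤_ (sym (ℤ.*-identityʳ i)) (sym (ℤ.*-identityʳ j)) i≤j)

  fromℤ-mono-< : ∀ {i j} → i ℤ.< j → fromℤ i < fromℤ j
  fromℤ-mono-< {i} {j} i<j rewrite fromℤ≡mkℚ i | fromℤ≡mkℚ j =
    ℚ.*<* (subst₂ ℤ._<_ (sym (ℤ.*-identityʳ i)) (sym (ℤ.*-identityʳ j)) i<j)

  fromℤ-cancel-≤ : ∀ {i j} → fromℤ i ≤ fromℤ j → i ℤ.≤ j
  fromℤ-cancel-≤ {i} {j} i≤j rewrite fromℤ≡mkℚ i | fromℤ≡mkℚ j with i≤j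
  ... | ℚ.*≤* i*1≤j*1 = subst₂ ℤ._≤_ (ℤ.*-identityʳ i) (ℤ.*-identityʳ j) i*1≤j*1

  fromℤ-cancel-< : ∀ {i j} → fromℤ i < fromℤ j → i ℤ.< j
  fromℤ-cancel-< {i} {j} i<j rewrite fromℤ≡mkℚ i | fromℤ≡mkℚ j with i<j
  ... | ℚ.*<* i*1<j*1 = subst₂ ℤ._<_ (ℤ.*-identityʳ i) (ℤ.*-identityʳ j) i*1<j*1

  0≤ℚof : ∀ a → 0ℚ ≤ ℚof a
  0≤ℚof a = fromℤ-mono-≤ {+ 0} {+ a} (ℤ.+≤+ z≤n)

  0<ℚof : ∀ {a} → 1 ℕ.≤ a → 0ℚ < ℚof a
  0<ℚof {a} 1≤a = fromℤ-mono-< {+ 0} {+ a} (ℤ.+<+ 1≤a)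

  1≤ℚof : ∀ {a} → 1 ℕ.≤ a → 1ℚ ≤ ℚof a
  1≤ℚof {a} 1≤a = fromℤ-mono-≤ {+ 1} {+ a} (ℤ.+≤+ 1≤a)

  floor-≤ : ∀ p → fromℤ (floor p) ≤ p
  floor-≤ p@(mkℚ n d _) rewrite fromℤ≡mkℚ (floor p) =
    ℚ.*≤* (subst (ℤ._≤_ _) (sym (ℤ.*-identityʳ n)) (ℤ.[n/d]*d≤n n (+ suc d)))

  <-suc-floor : ∀ p → p < fromℤ (ℤ.suc (floor p))
  <-suc-floor p@(mkℚ n d _) rewrite fromℤ≡mkℚ (ℤ.suc (floor p)) =
    ℚ.*<* (subst₂ ℤ._<_ (sym (ℤ.*-identityʳ n))
                        (cong (λ z → ℤ.suc z ℤ.* + suc d) (sym (ℤ.div-pos-is-/ℕ n (suc d))))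
                        (ℤ.n<s[n/ℕd]*d n (suc d)))

  ceiling≡-floor-neg : ∀ x → ceiling x ≡ ℤ.- floor (- x)
  ceiling≡-floor-neg record{} = refl

  ceilingGap : ℚ → ℚ
  ceilingGap x = fromℤ (ceiling x) - x

  ceilingGap-bounds : ∀ x → 0ℚ ≤ ceilingGap x × ceilingGap x < 1ℚ
  ceilingGap-bounds x = subst (λ g → 0ℚ ≤ g × g < 1ℚ) (sym gap≡) (gap-bounds (floor-≤ (- x)) -x<1+f)
    where
    f = floor (- x)
    gap≡ : ceilingGap x ≡ - fromℤ f - x
    gap≡ = cong (_- x) (trans (cong fromℤ (ceiling≡-floor-neg x)) (fromℤ-neg f))
    -x<1+f : - x < 1ℚ + fromℤ f
    -x<1+f = subst (- x <_) (fromℤ-+ (+ 1) f) (<-suc-floor (- x))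
    gap-bounds : ∀ {g} → g ≤ - x → - x < 1ℚ + g → 0ℚ ≤ - g - x × - g - x < 1ℚ
    gap-bounds {g} g≤-x -x<1+g = lower , 0<q-p⇒p<q upper
      where
      lower = begin
        0ℚ       ≤⟨ p≤q⇒0≤q-p g≤-x ⟩
        - x - g  ≡⟨ solve (x ∷ g ∷ []) ℚ-ring ⟩
        - g - x  ∎
      upper = begin-strict
        0ℚ              <⟨ p<q⇒0<q-p -x<1+g ⟩
        1ℚ + g - - x    ≡⟨ solve (x ∷ g ∷ []) ℚ-ring ⟩
        1ℚ - (- g - x)  ∎

  i≤+∣i∣ : ∀ i → i ℤ.≤ + ℤ.∣ i ∣
  i≤+∣i∣ (+ _)    = ℤ.≤-refl
  i≤+∣i∣ -[1+ _ ] = ℤ.-≤+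

  archimedean : ∀ {ε} C → 0ℚ < ε → Σ ℕ λ N → ∀ n → N ℕ.≤ n → C < ε * ℚof (suc n)
  archimedean {ε} C 0<ε = ℤ.∣ ceiling r ∣ , λ n N≤n → begin-strict
      C                 ≡⟨ ℚ.*-identityʳ C ⟨
      C * 1ℚ            ≡⟨ cong (C *_) (ℚ.*-inverseʳ ε) ⟨
      C * (ε * ℚ.1/ ε)  ≡⟨ swap C ε (ℚ.1/ ε) ⟩
      ε * r             <⟨ ℚ.*-monoʳ-<-pos ε {{ℚ.positive 0<ε}} (r<n+1 n N≤n) ⟩
      ε * ℚof (suc n)   ∎
    where
    instance
      ε≢0 : ℚ.NonZero ε
      ε≢0 = ℚ.>-nonZero 0<ε
    r : ℚ
    r = C * ℚ.1/ ε
    swap : ∀ x y z → x * (y * z) ≡ y * (x * z)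
    swap = solve-∀ ℚ-ring
    r<n+1 : ∀ n → ℤ.∣ ceiling r ∣ ℕ.≤ n → r < ℚof (suc n)
    r<n+1 n N≤n = ℚ.≤-<-trans (0≤q-p⇒p≤q (proj₁ (ceilingGap-bounds r)))
                              (fromℤ-mono-< (ℤ.≤-<-trans (i≤+∣i∣ (ceiling r)) (ℤ.+<+ (s≤s N≤n))))

  -- The algorithm and its digits

  ≡ᵇ-refl : ∀ n → (n ≡ᵇ n) ≡ true
  ≡ᵇ-refl zero    = refl
  ≡ᵇ-refl (suc n) = ≡ᵇ-refl n

  >⇒≡ᵇ-false : ∀ {m n} → m ℕ.< n → (n ≡ᵇ m) ≡ false
  >⇒≡ᵇ-false {zero}  {suc n} _         = refl
  >⇒≡ᵇ-false {suc m} {suc n} (s≤s m<n) = >⇒≡ᵇ-false m<n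

  module _ (a i : ℕ) (f : ℕ → ℚ) where

    step-here : step a i f i ≡ fromℤ (ceiling (f i))
    step-here rewrite ≡ᵇ-refl i = refl

    step-next : step a i f (suc i) ≡ f (suc i) + ℚof a * ceilingGap (f i)
    step-next rewrite >⇒≡ᵇ-false (ℕ.n<1+n i) | ≡ᵇ-refl i = refl

    step-next₂ : step a i f (suc (suc i)) ≡ f (suc (suc i)) - ceilingGap (f i)
    step-next₂ rewrite >⇒≡ᵇ-false (ℕ.m<n⇒m<1+n (ℕ.n<1+n i)) | >⇒≡ᵇ-false (ℕ.n<1+n i) | ≡ᵇ-refl i = refl

    step-beyond : ∀ {j} → suc (suc i) ℕ.< j → step a i f j ≡ f j
    step-beyond {j} i+2<j
      rewrite >⇒≡ᵇ-false (ℕ.<-trans (ℕ.n<1+n i) (ℕ.<-trans (ℕ.n<1+n (suc i)) i+2<j))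
            | >⇒≡ᵇ-false (ℕ.<-trans (ℕ.n<1+n (suc i)) i+2<j)
            | >⇒≡ᵇ-false i+2<j = refl

  carry : ℕ → ℚ × ℚ → ℚ × ℚ
  carry a (x , y) = y + ℚof a * ceilingGap x , - ceilingGap x

  -- (s⁽ⁿ⁾ₙ , s⁽ⁿ⁾ₙ₊₁), the two live entries of the n-th state.
  window : ℕ → ℚ → ℕ → ℚ × ℚ
  window a q zero    = q , 0ℚ
  window a q (suc n) = carry a (window a q n)

  module _ (a : ℕ) (q : ℚ) where

    X Y : ℕ → ℚ
    X n = proj₁ (window a q n)
    Y n = proj₂ (window a q n)

    state-beyond : ∀ n {j} → suc n ℕ.< j → state a q n j ≡ 0ℚ
    state-beyond zero    {suc zero}    (s≤s ())
    state-beyond zero    {suc (suc j)} _     = refl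
    state-beyond (suc n) {j}           n+1<j =
      trans (step-beyond a n (state a q n) n+1<j) (state-beyond n (ℕ.<⇒≤ n+1<j))

    state≡window : ∀ n → state a q n n ≡ X n × state a q n (suc n) ≡ Y n
    state≡window zero    = refl , refl
    state≡window (suc n) with x≡ , y≡ ← state≡window n =
      trans (step-next a n s) (cong₂ (λ y x → y + ℚof a * ceilingGap x) y≡ x≡) ,
      trans (step-next₂ a n s) (trans (cong₂ (λ z x → z - ceilingGap x) (state-beyond n (ℕ.n<1+n (suc n))) x≡)
                                      (ℚ.+-identityˡ (- ceilingGap (X n))))
      where s = state a q n

    output≡ceiling : ∀ n → output a q n ≡ fromℤ (ceiling (X n))
    output≡ceiling n = trans (step-here a n (state a q n)) (cong (fromℤ ∘ ceiling) (proj₁ (state≡window n)))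

  InBox : ℕ → ℚ × ℚ → Set
  InBox a (x , y) = (- 1ℚ < x × x < ℚof a) × (- 1ℚ < y × y ≤ 0ℚ)

  carry-InBox : ∀ {a} → 1 ℕ.≤ a → ∀ w → InBox a w → InBox a (carry a w)
  carry-InBox {a} 1≤a (x , y) (_ , -1<y , y≤0) = (lower , upper) , ℚ.neg-antimono-< δ<1 , ℚ.neg-antimono-≤ 0≤δ
    where
    A = ℚof a
    δ = ceilingGap x
    0≤δ = proj₁ (ceilingGap-bounds x)
    δ<1 = proj₂ (ceilingGap-bounds x)
    lower : - 1ℚ < y + A * δ
    lower = ℚ.+-mono-<-≤ -1<y (*-nonNeg (0≤ℚof a) 0≤δ)
    upper : y + A * δ < A
    upper = begin-strict
      y + A * δ    <⟨ ℚ.+-mono-≤-< y≤0 (ℚ.*-monoʳ-<-pos A {{ℚ.positive (0<ℚof 1≤a)}} δ<1) ⟩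
      0ℚ + A * 1ℚ  ≡⟨ trans (ℚ.+-identityˡ (A * 1ℚ)) (ℚ.*-identityʳ A) ⟩
      A            ∎

  window-InBox : ∀ {a q} → 1 ℕ.≤ a → - 1ℚ < q → q < 1ℚ → ∀ n → InBox a (window a q n)
  window-InBox 1≤a -1<q q<1 zero    = (-1<q , ℚ.<-≤-trans q<1 (1≤ℚof 1≤a)) , ℚ.negative⁻¹ (- 1ℚ) , ℚ.≤-refl
  window-InBox 1≤a -1<q q<1 (suc n) = carry-InBox 1≤a _ (window-InBox 1≤a -1<q q<1 n)

  ceiling-digit : ∀ {a x} → - 1ℚ < x → x < ℚof a → Σ ℕ λ k → k ℕ.≤ a × fromℤ (ceiling x) ≡ + k / 1
  ceiling-digit {a} {x} -1<x x<a = digit (ceiling x) (fromℤ-cancel-< lower) (fromℤ-cancel-< upper)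
    where
    p≡p-q+q : ∀ p q → p ≡ p - q + q
    p≡p-q+q = solve-∀ ℚ-ring
    lower : fromℤ -[1+ 0 ] < fromℤ (ceiling x)
    lower = ℚ.<-≤-trans -1<x (0≤q-p⇒p≤q (proj₁ (ceilingGap-bounds x)))
    upper : fromℤ (ceiling x) < fromℤ (+ suc a)
    upper = begin-strict
      fromℤ (ceiling x)  ≡⟨ p≡p-q+q (fromℤ (ceiling x)) x ⟩
      ceilingGap x + x   <⟨ ℚ.+-mono-< (proj₂ (ceilingGap-bounds x)) x<a ⟩
      1ℚ + ℚof a         ≡⟨ fromℤ-+ (+ 1) (+ a) ⟨
      fromℤ (+ suc a)    ∎
    digit : ∀ c → -[1+ 0 ] ℤ.< c → c ℤ.< + suc a → Σ ℕ λ k → k ℕ.≤ a × fromℤ c ≡ + k / 1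
    digit (+ k) ℤ.-<+ (ℤ.+<+ (s≤s k≤a)) = k , k≤a , refl

  -- The grid (1/D)ℤ and periodicity

  record OnGrid (D : ℕ) (r : ℚ) : Set where
    constructor onGrid
    field
      scaled   : ℤ
      scaled-≡ : r * ℚof D ≡ fromℤ scaled

  module _ {D : ℕ} where

    onGrid-fromℤ : ∀ z → OnGrid D (fromℤ z)
    onGrid-fromℤ z = onGrid (z ℤ.* + D) (sym (fromℤ-* z (+ D)))

    onGrid-+ : ∀ {r s} → OnGrid D r → OnGrid D s → OnGrid D (r + s)
    onGrid-+ {r} {s} (onGrid z rD≡z) (onGrid w sD≡w) = onGrid (z ℤ.+ w) (begin-equality
      (r + s) * ℚof D        ≡⟨ ℚ.*-distribʳ-+ (ℚof D) r s ⟩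
      r * ℚof D + s * ℚof D  ≡⟨ cong₂ _+_ rD≡z sD≡w ⟩
      fromℤ z + fromℤ w      ≡⟨ fromℤ-+ z w ⟨
      fromℤ (z ℤ.+ w)        ∎)

    onGrid-neg : ∀ {r} → OnGrid D r → OnGrid D (- r)
    onGrid-neg {r} (onGrid z rD≡z) = onGrid (ℤ.- z) (begin-equality
      - r * ℚof D    ≡⟨ ℚ.neg-distribˡ-* r (ℚof D) ⟨
      - (r * ℚof D)  ≡⟨ cong -_ rD≡z ⟩
      - fromℤ z      ≡⟨ fromℤ-neg z ⟨
      fromℤ (ℤ.- z)  ∎)

    onGrid-scale : ∀ k {r} → OnGrid D r → OnGrid D (fromℤ k * r)
    onGrid-scale k {r} (onGrid z rD≡z) = onGrid (k ℤ.* z) (begin-equality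
      fromℤ k * r * ℚof D    ≡⟨ ℚ.*-assoc (fromℤ k) r (ℚof D) ⟩
      fromℤ k * (r * ℚof D)  ≡⟨ cong (fromℤ k *_) rD≡z ⟩
      fromℤ k * fromℤ z      ≡⟨ fromℤ-* k z ⟨
      fromℤ (k ℤ.* z)        ∎)

    onGrid-ceilingGap : ∀ {x} → OnGrid D x → OnGrid D (ceilingGap x)
    onGrid-ceilingGap {x} x∈ = onGrid-+ (onGrid-fromℤ (ceiling x)) (onGrid-neg x∈)

  onGrid-denominator : ∀ q → OnGrid (↧ₙ q) q
  onGrid-denominator q@(mkℚ n d _) = onGrid n q*D≡n
    where
    nd≡n : (n ℤ.* + suc d) ℤ.* + 1 ≡ n ℤ.* + suc (d ℕ.* 1)
    nd≡n rewrite ℕ.*-identityʳ d = ℤ.*-identityʳ _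
    q*D≡n : q * fromℤ (+ suc d) ≡ fromℤ n
    q*D≡n rewrite fromℤ≡mkℚ (+ suc d) | fromℤ≡mkℚ n =
      ℚ.toℚᵘ-injective (ℚᵘ.≃-trans (ℚ.toℚᵘ-homo-* q (mkℚ (+ suc d) 0 (coprime-sym (1-coprimeTo (suc d)))))
                                   (ℚᵘ.*≡* nd≡n))

  window-onGrid : ∀ a q n → OnGrid (↧ₙ q) (X a q n) × OnGrid (↧ₙ q) (Y a q n)
  window-onGrid a q zero    = onGrid-denominator q , onGrid-fromℤ (+ 0)
  window-onGrid a q (suc n) with x∈ , y∈ ← window-onGrid a q n =
    onGrid-+ y∈ (onGrid-scale (+ a) (onGrid-ceilingGap x∈)) , onGrid-neg (onGrid-ceilingGap x∈)

  record GridPoint (a D : ℕ) (r : ℚ) : Set where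
    constructor gridPoint
    field
      on-grid : OnGrid D r
      -1<r    : - 1ℚ < r
      r<a     : r < ℚof a

  module _ {D : ℕ} .{{_ : ℕ.NonZero D}} where

    private
      0<D : 0ℚ < ℚof D
      0<D = 0<ℚof (ℕ.>-nonZero⁻¹ D)

      toFin : ∀ {B} w → + 0 ℤ.≤ w → w ℤ.< + B → Σ (Fin B) λ i → + toℕ i ≡ w
      toFin (+ k) _ (ℤ.+<+ k<B) = fromℕ< k<B , cong +_ (Fin.toℕ-fromℕ< k<B)

    onGrid-nonNeg : ∀ {r} → OnGrid D r → 0ℚ ≤ r → r ≡ 0ℚ ⊎ 1ℚ ≤ r * ℚof D
    onGrid-nonNeg {r} (onGrid z rD≡z) 0≤r =
      by-cases z rD≡z (fromℤ-cancel-≤ (subst (0ℚ ≤_) rD≡z (*-nonNeg 0≤r (ℚ.<⇒≤ 0<D))))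
      where
      by-cases : ∀ z → r * ℚof D ≡ fromℤ z → + 0 ℤ.≤ z → r ≡ 0ℚ ⊎ 1ℚ ≤ r * ℚof D
      by-cases (+ zero)   rD≡0 _ = inj₁ (*-cancelʳ-≡-pos (ℚof D) 0<D (trans rD≡0 (sym (ℚ.*-zeroˡ (ℚof D)))))
      by-cases ℤ.+[1+ k ] rD≡z _ = inj₂ (subst (1ℚ ≤_) (sym rD≡z) (1≤ℚof {suc k} (s≤s z≤n)))

    gridIndex : ∀ {a r} → GridPoint a D r → Σ (Fin (suc a ℕ.* D)) λ i → fromℤ (+ toℕ i) ≡ r * ℚof D + ℚof D
    gridIndex {a} {r} (gridPoint (onGrid z rD≡z) -1<r r<a) = proj₁ index , trans (cong fromℤ (proj₂ index)) z+D≡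
      where
      shift : ∀ r d → r * d + d ≡ (r - - 1ℚ) * d
      shift = solve-∀ ℚ-ring
      gap : ∀ r A d → (1ℚ + A) * d - (r * d + d) ≡ (A - r) * d
      gap = solve-∀ ℚ-ring
      z+D≡ : fromℤ (z ℤ.+ + D) ≡ r * ℚof D + ℚof D
      z+D≡ = trans (fromℤ-+ z (+ D)) (cong (_+ ℚof D) (sym rD≡z))
      [1+a]D≡ : fromℤ (+ (suc a ℕ.* D)) ≡ (1ℚ + ℚof a) * ℚof D
      [1+a]D≡ = trans (cong fromℤ (ℤ.pos-* (suc a) D))
                      (trans (fromℤ-* (+ suc a) (+ D)) (cong (_* ℚof D) (fromℤ-+ (+ 1) (+ a))))
      lower : 0ℚ ≤ fromℤ (z ℤ.+ + D)
      lower = begin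
        0ℚ                     ≤⟨ *-nonNeg (p≤q⇒0≤q-p (ℚ.<⇒≤ -1<r)) (ℚ.<⇒≤ 0<D) ⟩
        (r - - 1ℚ) * ℚof D     ≡⟨ trans z+D≡ (shift r (ℚof D)) ⟨
        fromℤ (z ℤ.+ + D)      ∎
      upper : fromℤ (z ℤ.+ + D) < fromℤ (+ (suc a ℕ.* D))
      upper = 0<q-p⇒p<q (begin-strict
        0ℚ                                              <⟨ *-pos (p<q⇒0<q-p r<a) 0<D ⟩
        (ℚof a - r) * ℚof D                             ≡⟨ gap r (ℚof a) (ℚof D) ⟨
        (1ℚ + ℚof a) * ℚof D - (r * ℚof D + ℚof D)      ≡⟨ cong₂ _-_ [1+a]D≡ z+D≡ ⟨
        fromℤ (+ (suc a ℕ.* D)) - fromℤ (z ℤ.+ + D)     ∎)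
      index : Σ (Fin (suc a ℕ.* D)) λ i → + toℕ i ≡ z ℤ.+ + D
      index = toFin (z ℤ.+ + D) (fromℤ-cancel-≤ {+ 0} lower) (fromℤ-cancel-< upper)

    gridIndex-injective : ∀ {a r s} (g : GridPoint a D r) (h : GridPoint a D s) →
                          proj₁ (gridIndex g) ≡ proj₁ (gridIndex h) → r ≡ s
    gridIndex-injective {r = r} {s} g h same =
      *-cancelʳ-≡-pos (ℚof D) 0<D (+-cancelʳ (ℚof D) (r * ℚof D) (s * ℚof D) (begin-equality
        r * ℚof D + ℚof D                    ≡⟨ proj₂ (gridIndex g) ⟨
        fromℤ (+ toℕ (proj₁ (gridIndex g)))  ≡⟨ cong (fromℤ ∘ +_ ∘ toℕ) same ⟩
        fromℤ (+ toℕ (proj₁ (gridIndex h)))  ≡⟨ proj₂ (gridIndex h) ⟩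
        s * ℚof D + ℚof D                    ∎))

  module _ {a} (1≤a : 1 ℕ.≤ a) {q} (-1<q : - 1ℚ < q) (q<1 : q < 1ℚ) where

    private
      D = ↧ₙ q
      box = window-InBox 1≤a -1<q q<1

    output-digit : ∀ i → Σ ℕ λ k → k ℕ.≤ a × output a q i ≡ + k / 1
    output-digit i = subst (λ o → Σ ℕ λ k → k ℕ.≤ a × o ≡ + k / 1) (sym (output≡ceiling a q i))
                           (ceiling-digit {a} {X a q i} (proj₁ (proj₁ (box i))) (proj₂ (proj₁ (box i))))

    X-gridPoint : ∀ n → GridPoint a D (X a q n)
    X-gridPoint n = gridPoint (proj₁ (window-onGrid a q n)) (proj₁ (proj₁ (box n))) (proj₂ (proj₁ (box n)))

    Y-gridPoint : ∀ n → GridPoint a D (Y a q n)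
    Y-gridPoint n = gridPoint (proj₂ (window-onGrid a q n)) (proj₁ (proj₂ (box n)))
                              (ℚ.≤-<-trans (proj₂ (proj₂ (box n))) (0<ℚof 1≤a))

    windowIndex : ℕ → Fin (suc a ℕ.* D ℕ.* (suc a ℕ.* D))
    windowIndex n = combine (proj₁ (gridIndex (X-gridPoint n))) (proj₁ (gridIndex (Y-gridPoint n)))

    windowIndex-injective : ∀ {i j} → windowIndex i ≡ windowIndex j → window a q i ≡ window a q j
    windowIndex-injective {i} {j} same with x≡ , y≡ ← Fin.combine-injective _ _ _ _ same =
      cong₂ _,_ (gridIndex-injective (X-gridPoint i) (X-gridPoint j) x≡)
                (gridIndex-injective (Y-gridPoint i) (Y-gridPoint j) y≡)

    output-eventuallyPeriodic : EventuallyPeriodic (output a q)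
    output-eventuallyPeriodic =
      eventuallyPeriodic-map (fromℤ ∘ ceiling ∘ proj₁) (output≡ceiling a q)
        (finite⇒eventuallyPeriodic (carry a) (window a q) (λ _ → refl) windowIndex windowIndex-injective)

  -- Arithmetic in ℚ(α)

  -- N(u + v α) = (u + v α) (u + v β) for the conjugate β = a - α, using α β = -1.
  norm : ℚ → ℚ → ℚ → ℚ
  norm A u v = u * u + A * u * v - v * v

  normα : ℕ → ℚα → ℚ
  normα a z = norm (ℚof a) (re z) (im z)

  norm-mul : ∀ A u v u′ v′ →
             norm A (u * u′ + v * v′) (u * v′ + v * u′ + A * (v * v′)) ≡ norm A u v * norm A u′ v′
  norm-mul A u v u′ v′ = begin-equality
    (u * u′ + v * v′) * (u * u′ + v * v′) + A * (u * u′ + v * v′) * (u * v′ + v * u′ + A * (v * v′))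
      - (u * v′ + v * u′ + A * (v * v′)) * (u * v′ + v * u′ + A * (v * v′))
      ≡⟨ solve (A ∷ u ∷ v ∷ u′ ∷ v′ ∷ []) ℚ-ring ⟩
    (u * u + A * u * v - v * v) * (u′ * u′ + A * u′ * v′ - v′ * v′) ∎

  normα-mulα : ∀ a z z′ → normα a (mulα a z z′) ≡ normα a z * normα a z′
  normα-mulα a z z′ = norm-mul (ℚof a) (re z) (im z) (re z′) (im z′)

  norm-times-α : ∀ A p w → norm A w (p + A * w) ≡ - norm A p w
  norm-times-α A p w = begin-equality
    w * w + A * w * (p + A * w) - (p + A * w) * (p + A * w)  ≡⟨ solve (A ∷ p ∷ w ∷ []) ℚ-ring ⟩
    - (p * p + A * p * w - w * w)                            ∎

  norm-bounds : ∀ {A d₀ d₁} → 0ℚ ≤ A → 0ℚ ≤ d₀ → d₀ < 1ℚ → 0ℚ ≤ d₁ → d₁ < 1ℚ →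
                - (A + 1ℚ) ≤ norm A d₁ d₀ × norm A d₁ d₀ ≤ A + 1ℚ
  norm-bounds {A} {d₀} {d₁} 0≤A 0≤d₀ d₀<1 0≤d₁ d₁<1 = 0≤q-p⇒p≤q lower , 0≤q-p⇒p≤q upper
    where
    0≤1 = ℚ.nonNegative⁻¹ 1ℚ
    0≤1-d₀ = p≤q⇒0≤q-p (ℚ.<⇒≤ d₀<1)
    0≤1-d₁ = p≤q⇒0≤q-p (ℚ.<⇒≤ d₁<1)
    lower = begin
      0ℚ
        ≤⟨ ℚ.+-mono-≤ (ℚ.+-mono-≤ (*-nonNeg 0≤1-d₀ (ℚ.+-mono-≤ 0≤1 0≤d₀))
                                  (*-nonNeg 0≤A (ℚ.+-mono-≤ 0≤1 (*-nonNeg 0≤d₁ 0≤d₀))))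
                      (*-nonNeg 0≤d₁ 0≤d₁) ⟩
      (1ℚ - d₀) * (1ℚ + d₀) + A * (1ℚ + d₁ * d₀) + d₁ * d₁
        ≡⟨ solve (A ∷ d₀ ∷ d₁ ∷ []) ℚ-ring ⟩
      d₁ * d₁ + A * d₁ * d₀ - d₀ * d₀ - - (A + 1ℚ) ∎
    upper = begin
      0ℚ
        ≤⟨ ℚ.+-mono-≤ (ℚ.+-mono-≤ (*-nonNeg 0≤1-d₁ (ℚ.+-mono-≤ 0≤1 0≤d₁))
                                  (*-nonNeg 0≤A (ℚ.+-mono-≤ 0≤1-d₁ (*-nonNeg 0≤d₁ 0≤1-d₀))))
                      (*-nonNeg 0≤d₀ 0≤d₀) ⟩
      (1ℚ - d₁) * (1ℚ + d₁) + A * ((1ℚ - d₁) + d₁ * (1ℚ - d₀)) + d₀ * d₀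
        ≡⟨ solve (A ∷ d₀ ∷ d₁ ∷ []) ℚ-ring ⟩
      A + 1ℚ - (d₁ * d₁ + A * d₁ * d₀ - d₀ * d₀) ∎

  ±-bounded : ∀ {M x s} → - M ≤ x × x ≤ M → s ≡ 1ℚ ⊎ s ≡ - 1ℚ → - M ≤ x * s × x * s ≤ M
  ±-bounded {M} {x} bounds (inj₁ refl) = subst (λ y → - M ≤ y × y ≤ M) (sym (ℚ.*-identityʳ x)) bounds
  ±-bounded {M} {x} (-M≤x , x≤M) (inj₂ refl) =
    subst (λ y → - M ≤ y × y ≤ M) (times-minus-one x)
          (ℚ.neg-antimono-≤ x≤M , subst (- x ≤_) (neg-involutive M) (ℚ.neg-antimono-≤ -M≤x))
    where
    times-minus-one : ∀ x → - x ≡ x * - 1ℚ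
    times-minus-one = solve-∀ ℚ-ring
    neg-involutive : ∀ M → - - M ≡ M
    neg-involutive = solve-∀ ℚ-ring

  αPower : ℕ → ℕ → ℚα
  αPower a zero    = 1ℚ + 0ℚ α
  αPower a (suc n) = im (αPower a n) + (re (αPower a n) + ℚof a * im (αPower a n)) α

  powα≡αPower : ∀ a n → powα a αₐ n ≡ αPower a n
  powα≡αPower a zero    = refl
  powα≡αPower a (suc n) =
    trans (cong (λ z → mulα a z αₐ) (powα≡αPower a n)) (cong₂ _+_α (re-times-α p w) (im-times-α (ℚof a) p w))
    where
    p = re (αPower a n)
    w = im (αPower a n)
    re-times-α : ∀ p w → p * 0ℚ + w * 1ℚ ≡ w
    re-times-α = solve-∀ ℚ-ring
    im-times-α : ∀ A p w → p * 1ℚ + w * 0ℚ + A * (w * 1ℚ) ≡ p + A * w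
    im-times-α = solve-∀ ℚ-ring

  normα-αPower : ∀ a n → normα a (αPower a n) ≡ 1ℚ ⊎ normα a (αPower a n) ≡ - 1ℚ
  normα-αPower a zero = inj₁ (begin-equality
    1ℚ * 1ℚ + A * 1ℚ * 0ℚ - 0ℚ * 0ℚ  ≡⟨ cong (λ z → 1ℚ * 1ℚ + z - 0ℚ * 0ℚ) (ℚ.*-zeroʳ (A * 1ℚ)) ⟩
    1ℚ * 1ℚ + 0ℚ - 0ℚ * 0ℚ           ≡⟨⟩
    1ℚ                               ∎)
    where A = ℚof a
  normα-αPower a (suc n) with normα-αPower a n
  ... | inj₁ N≡1  = inj₂ (trans (norm-times-α (ℚof a) (re (αPower a n)) (im (αPower a n))) (cong -_ N≡1))
  ... | inj₂ N≡-1 = inj₁ (trans (norm-times-α (ℚof a) (re (αPower a n)) (im (αPower a n))) (cong -_ N≡-1))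

  αPower-nonNeg : ∀ a n → 0ℚ ≤ re (αPower a n) × 0ℚ ≤ im (αPower a n)
  αPower-nonNeg a zero    = ℚ.nonNegative⁻¹ 1ℚ , ℚ.≤-refl
  αPower-nonNeg a (suc n) with 0≤p , 0≤w ← αPower-nonNeg a n = 0≤w , ℚ.+-mono-≤ 0≤p (*-nonNeg (0≤ℚof a) 0≤w)

  αPower-growth-step : ∀ {A p w m} → 1ℚ ≤ A → 0ℚ ≤ p → 1ℚ ≤ w → m ≤ p + w →
                       1ℚ ≤ p + A * w × 1ℚ + m ≤ w + (p + A * w)
  αPower-growth-step {A} {p} {w} {m} 1≤A 0≤p 1≤w m≤p+w = (begin
      1ℚ           ≤⟨ 1≤w ⟩
      w            ≡⟨ solve (w ∷ []) ℚ-ring ⟩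
      0ℚ + 1ℚ * w  ≤⟨ ℚ.+-mono-≤ 0≤p w≤Aw ⟩
      p + A * w    ∎) , (begin
      1ℚ + m            ≤⟨ ℚ.+-mono-≤ 1≤w m≤p+w ⟩
      w + (p + w)       ≡⟨ solve (p ∷ w ∷ []) ℚ-ring ⟩
      w + (p + 1ℚ * w)  ≤⟨ ℚ.+-monoʳ-≤ w (ℚ.+-monoʳ-≤ p w≤Aw) ⟩
      w + (p + A * w)   ∎)
    where
    w≤Aw : 1ℚ * w ≤ A * w
    w≤Aw = ℚ.*-monoʳ-≤-nonNeg w {{ℚ.nonNegative (ℚ.≤-trans (ℚ.nonNegative⁻¹ 1ℚ) 1≤w)}} 1≤A

  αPower-growth : ∀ {a} → 1 ℕ.≤ a → ∀ n →
                  1ℚ ≤ im (αPower a (suc n)) × ℚof (suc n) ≤ re (αPower a (suc n)) + im (αPower a (suc n))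
  αPower-growth {a} 1≤a zero = ℚ.≤-reflexive (one (ℚof a)) , ℚ.≤-reflexive (one′ (ℚof a))
    where
    one : ∀ A → 1ℚ ≡ 1ℚ + A * 0ℚ
    one = solve-∀ ℚ-ring
    one′ : ∀ A → 1ℚ ≡ 0ℚ + (1ℚ + A * 0ℚ)
    one′ = solve-∀ ℚ-ring
  αPower-growth {a} 1≤a (suc n) = proj₁ next , subst (_≤ p + w) (sym (fromℤ-+ (+ 1) (+ suc n))) (proj₂ next)
    where
    p = re (αPower a (suc (suc n)))
    w = im (αPower a (suc (suc n)))
    previous = αPower-growth 1≤a n
    next = αPower-growth-step (1≤ℚof 1≤a) (proj₁ (αPower-nonNeg a (suc n))) (proj₁ previous) (proj₂ previous)

  product-bounds : ∀ {A d₀ d₁ p w} → 1ℚ ≤ A → 0ℚ ≤ d₀ → 0ℚ ≤ d₁ → 0ℚ ≤ p → 0ℚ ≤ w →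
    let U = d₁ * p + d₀ * w; V = d₁ * w + d₀ * p + A * (d₀ * w) in
    0ℚ ≤ U × (d₁ + d₀) * w ≤ V × (d₁ + d₀) * (p + w) ≤ U + U + A * V
  product-bounds {A} {d₀} {d₁} {p} {w} 1≤A 0≤d₀ 0≤d₁ 0≤p 0≤w =
    ℚ.+-mono-≤ (*-nonNeg 0≤d₁ 0≤p) (*-nonNeg 0≤d₀ 0≤w) , 0≤q-p⇒p≤q V-bound , 0≤q-p⇒p≤q trace-bound
    where
    0≤A-1 = p≤q⇒0≤q-p 1≤A
    0≤A = ℚ.≤-trans (ℚ.nonNegative⁻¹ 1ℚ) 1≤A
    V-bound = begin
      0ℚ                                              ≤⟨ ℚ.+-mono-≤ (*-nonNeg 0≤d₀ 0≤p)
                                                                    (*-nonNeg 0≤A-1 (*-nonNeg 0≤d₀ 0≤w)) ⟩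
      d₀ * p + (A - 1ℚ) * (d₀ * w)                    ≡⟨ solve (A ∷ d₀ ∷ d₁ ∷ p ∷ w ∷ []) ℚ-ring ⟩
      d₁ * w + d₀ * p + A * (d₀ * w) - (d₁ + d₀) * w  ∎
    trace-bound = begin
      0ℚ
        ≤⟨ ℚ.+-mono-≤ (ℚ.+-mono-≤ (ℚ.+-mono-≤ (*-nonNeg 0≤d₁ 0≤p) (*-nonNeg 0≤d₀ 0≤w))
                                  (*-nonNeg 0≤A-1 (ℚ.+-mono-≤ (*-nonNeg 0≤d₁ 0≤w) (*-nonNeg 0≤d₀ 0≤p))))
                      (*-nonNeg (*-nonNeg 0≤A 0≤A) (*-nonNeg 0≤d₀ 0≤w)) ⟩
      d₁ * p + d₀ * w + (A - 1ℚ) * (d₁ * w + d₀ * p) + A * A * (d₀ * w)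
        ≡⟨ solve (A ∷ d₀ ∷ d₁ ∷ p ∷ w ∷ []) ℚ-ring ⟩
      (d₁ * p + d₀ * w) + (d₁ * p + d₀ * w) + A * (d₁ * w + d₀ * p + A * (d₀ * w)) - (d₁ + d₀) * (p + w) ∎

  -- Posα reads u + v α as x + y √D with x = u + ½ a v, y = - ½ v and D = a² + 4,
  -- and x² - y² D is the norm.
  norm<0⇒x²<y²D : ∀ A u v → norm A u v < 0ℚ →
                  (u + ½ * A * v) * (u + ½ * A * v) < - (½ * v) * - (½ * v) * (A * A + ℚof 4)
  norm<0⇒x²<y²D A u v N<0 = 0<q-p⇒p<q (begin-strict
    0ℚ                                <⟨ p<q⇒0<q-p N<0 ⟩
    0ℚ - (u * u + A * u * v - v * v)  ≡⟨ solve (A ∷ u ∷ v ∷ []) ℚ-ring ⟩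
    - (½ * v) * - (½ * v) * (A * A + ℚof 4) - (u + ½ * A * v) * (u + ½ * A * v) ∎)

  norm>0⇒y²D<x² : ∀ A u v → 0ℚ < norm A u v →
                  - (½ * v) * - (½ * v) * (A * A + ℚof 4) < (u + ½ * A * v) * (u + ½ * A * v)
  norm>0⇒y²D<x² A u v 0<N = 0<q-p⇒p<q (begin-strict
    0ℚ                         <⟨ 0<N ⟩
    u * u + A * u * v - v * v  ≡⟨ solve (A ∷ u ∷ v ∷ []) ℚ-ring ⟩
    (u + ½ * A * v) * (u + ½ * A * v) - - (½ * v) * - (½ * v) * (A * A + ℚof 4) ∎)

  module _ (a : ℕ) where

    private
      A = ℚof a

    Posα-re : ∀ {u} → 0ℚ < u → Posα a (u + 0ℚ α)
    Posα-re {u} 0<u = inj₁ (ℚ.<⇒≤ 0<x , ℚ.≤-refl , inj₁ 0<x)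
      where
      drop-zero : ∀ A u → u ≡ u + ½ * A * 0ℚ
      drop-zero = solve-∀ ℚ-ring
      0<x : 0ℚ < u + ½ * A * 0ℚ
      0<x = subst (0ℚ <_) (drop-zero A u) 0<u

    Posα-norm<0 : ∀ {u v} → v < 0ℚ → normα a (u + v α) < 0ℚ → Posα a (u + v α)
    Posα-norm<0 {u} {v} v<0 N<0 = by-sign (u + ½ * A * v ℚ.<? 0ℚ)
      where
      0<y : 0ℚ < - (½ * v)
      0<y = ℚ.neg-antimono-< (ℚ.*-monoʳ-<-pos ½ v<0)
      by-sign : Dec (u + ½ * A * v < 0ℚ) → Posα a (u + v α)
      by-sign (yes x<0) = inj₂ (inj₂ (x<0 , 0<y , norm<0⇒x²<y²D A u v N<0))
      by-sign (no  x≮0) = inj₁ (ℚ.≮⇒≥ x≮0 , ℚ.<⇒≤ 0<y , inj₂ 0<y)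

    Posα-norm>0 : ∀ {u v} → 0ℚ < v → 0ℚ < normα a (u + v α) → 0ℚ < u + u + A * v → Posα a (u + v α)
    Posα-norm>0 {u} {v} 0<v 0<N 0<trace =
      inj₂ (inj₁ (0<x , ℚ.neg-antimono-< (ℚ.*-monoʳ-<-pos ½ 0<v) , norm>0⇒y²D<x² A u v 0<N))
      where
      half-trace : ∀ A u v → ½ * (u + u + A * v) ≡ u + ½ * A * v
      half-trace = solve-∀ ℚ-ring
      0<x : 0ℚ < u + ½ * A * v
      0<x = begin-strict
        0ℚ                   <⟨ ℚ.*-monoʳ-<-pos ½ 0<trace ⟩
        ½ * (u + u + A * v)  ≡⟨ half-trace A u v ⟩
        u + ½ * A * v        ∎

    AbsLt-zero : ∀ {ε} → 0ℚ < ε → AbsLt a (0ℚ + 0ℚ α) ε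
    AbsLt-zero 0<ε = Posα-re (p<q⇒0<q-p 0<ε) , Posα-re (ℚ.+-mono-<-≤ 0<ε ℚ.≤-refl)

  -- For z = U + V α: N(ε ∓ z) = ε² ∓ ε Tr z + N z, so the hypotheses give N(ε - z) < 0 < N(ε + z);
  -- the conjugates ε ∓ z′ being negative and positive respectively, ε ∓ z are both positive.
  small-element-signs : ∀ {A ε U V M} → 0ℚ ≤ A → 0ℚ < ε → 0ℚ ≤ U → 0ℚ < V →
                        - M ≤ norm A U V → norm A U V ≤ M → ε * ε + M < ε * (U + U + A * V) →
                        (0ℚ - V < 0ℚ × norm A (ε - U) (0ℚ - V) < 0ℚ) ×
                        (0ℚ < 0ℚ + V × 0ℚ < norm A (ε + U) (0ℚ + V) × 0ℚ < (ε + U) + (ε + U) + A * (0ℚ + V))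
  small-element-signs {A} {ε} {U} {V} {M} 0≤A 0<ε 0≤U 0<V -M≤N N≤M εε+M<εT =
    (subst (_< 0ℚ) (sym (ℚ.+-identityˡ (- V))) (ℚ.neg-antimono-< 0<V) , below) ,
    (subst (0ℚ <_) (sym (ℚ.+-identityˡ V)) 0<V , above , trace)
    where
    0≤ε = ℚ.<⇒≤ 0<ε
    below = begin-strict
      (ε - U) * (ε - U) + A * (ε - U) * (0ℚ - V) - (0ℚ - V) * (0ℚ - V)
        ≡⟨ solve (A ∷ ε ∷ U ∷ V ∷ []) ℚ-ring ⟩
      ε * ε + (U * U + A * U * V - V * V) - ε * (U + U + A * V)
        ≤⟨ ℚ.+-monoˡ-≤ (- (ε * (U + U + A * V))) (ℚ.+-monoʳ-≤ (ε * ε) N≤M) ⟩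
      ε * ε + M - ε * (U + U + A * V)
        <⟨ ℚ.+-monoˡ-< (- (ε * (U + U + A * V))) εε+M<εT ⟩
      ε * (U + U + A * V) - ε * (U + U + A * V)
        ≡⟨ ℚ.+-inverseʳ (ε * (U + U + A * V)) ⟩
      0ℚ ∎
    above = begin-strict
      0ℚ
        ≤⟨ ℚ.+-mono-≤ (*-nonNeg 0≤ε 0≤ε) (*-nonNeg 0≤ε 0≤ε) ⟩
      ε * ε + ε * ε
        ≡⟨ solve (ε ∷ M ∷ []) ℚ-ring ⟩
      ε * ε + (ε * ε + M) + - M
        <⟨ ℚ.+-mono-<-≤ (ℚ.+-monoʳ-< (ε * ε) εε+M<εT) -M≤N ⟩
      ε * ε + ε * (U + U + A * V) + (U * U + A * U * V - V * V)
        ≡⟨ solve (A ∷ ε ∷ U ∷ V ∷ []) ℚ-ring ⟩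
      (ε + U) * (ε + U) + A * (ε + U) * (0ℚ + V) - (0ℚ + V) * (0ℚ + V) ∎
    trace = begin-strict
      0ℚ
        <⟨ ℚ.+-mono-<-≤ (ℚ.+-mono-< 0<ε 0<ε) (ℚ.+-mono-≤ (ℚ.+-mono-≤ 0≤U 0≤U) (*-nonNeg 0≤A (ℚ.<⇒≤ 0<V))) ⟩
      ε + ε + (U + U + A * V)
        ≡⟨ solve (A ∷ ε ∷ U ∷ V ∷ []) ℚ-ring ⟩
      (ε + U) + (ε + U) + A * (0ℚ + V) ∎

  AbsLt-intro : ∀ a {ε U V M} → 0ℚ < ε → 0ℚ ≤ U → 0ℚ < V →
                - M ≤ normα a (U + V α) → normα a (U + V α) ≤ M →
                ε * ε + M < ε * (U + U + ℚof a * V) → AbsLt a (U + V α) ε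
  AbsLt-intro a {ε} {U} {V} {M} 0<ε 0≤U 0<V -M≤N N≤M εε+M<εT =
    let (V<0 , N<0) , (0<V′ , 0<N , 0<trace) =
          small-element-signs {ℚof a} {ε} {U} {V} {M} (0≤ℚof a) 0<ε 0≤U 0<V -M≤N N≤M εε+M<εT
    in Posα-norm<0 a {ε - U} {0ℚ - V} V<0 N<0 , Posα-norm>0 a {ε + U} {0ℚ + V} 0<V′ 0<N 0<trace

  rescale : ∀ {C ε s n d} → 0ℚ < d → 0ℚ ≤ ε → 0ℚ ≤ n → 1ℚ ≤ s * d → C * d < ε * n → C < ε * (s * n)
  rescale {C} {ε} {s} {n} {d} 0<d 0≤ε 0≤n 1≤sd Cd<εn =
    ℚ.*-cancelʳ-<-nonNeg d {{ℚ.nonNegative (ℚ.<⇒≤ 0<d)}} (begin-strict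
      C * d            <⟨ Cd<εn ⟩
      ε * n            ≡⟨ solve (ε ∷ n ∷ []) ℚ-ring ⟩
      ε * n * 1ℚ       ≤⟨ *-monoˡ-≤-0≤ (*-nonNeg 0≤ε 0≤n) 1≤sd ⟩
      ε * n * (s * d)  ≡⟨ solve (ε ∷ s ∷ n ∷ d ∷ []) ℚ-ring ⟩
      ε * (s * n) * d  ∎)

  -- Convergence

  module _ (a : ℕ) (q : ℚ) where

    private
      A = ℚof a
      S = partialSum a (output a q)

    partialSum-step : ∀ n → S (suc n) ≡ addα (S n) (mulα a (embed (fromℤ (ceiling (X a q n)))) (αPower a n))
    partialSum-step n =
      cong₂ (λ d π → addα (S n) (mulα a (embed d) π)) (output≡ceiling a q n) (powα≡αPower a n)

    -- q = Sₙ + (xₙ + yₙ α) αⁿ, in coordinates.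
    Invariant : ℕ → ℚα → Set
    Invariant n s = re s + (x * p + y * w) ≡ q × im s + (x * w + y * (p + A * w)) ≡ 0ℚ
      where
      x = X a q n
      y = Y a q n
      p = re (αPower a n)
      w = im (αPower a n)

    partialSum-invariant : ∀ n → Invariant n (S n)
    partialSum-invariant zero = initial-re q , initial-im A q
      where
      initial-re : ∀ q → 0ℚ + (q * 1ℚ + 0ℚ * 0ℚ) ≡ q
      initial-re = solve-∀ ℚ-ring
      initial-im : ∀ A q → 0ℚ + (q * 0ℚ + 0ℚ * (1ℚ + A * 0ℚ)) ≡ 0ℚ
      initial-im = solve-∀ ℚ-ring
    partialSum-invariant (suc n) = subst (Invariant (suc n)) (sym (partialSum-step n))
      (trans (carry-re A (re (S n)) c (X a q n) (Y a q n) p w) (proj₁ (partialSum-invariant n)) ,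
       trans (carry-im A (im (S n)) c (X a q n) (Y a q n) p w) (proj₂ (partialSum-invariant n)))
      where
      c = fromℤ (ceiling (X a q n))
      p = re (αPower a n)
      w = im (αPower a n)
      carry-re : ∀ A R c x y p w →
        R + (c * p + 0ℚ * w) + ((y + A * (c - x)) * w + - (c - x) * (p + A * w)) ≡ R + (x * p + y * w)
      carry-re = solve-∀ ℚ-ring
      carry-im : ∀ A I c x y p w →
        I + (c * w + 0ℚ * p + A * (0ℚ * w))
          + ((y + A * (c - x)) * (p + A * w) + - (c - x) * (w + A * (p + A * w)))
          ≡ I + (x * w + y * (p + A * w))
      carry-im = solve-∀ ℚ-ring

    remainder : ∀ m → subα (S (suc (suc m))) (embed q) ≡
                      mulα a (ceilingGap (X a q (suc m)) + ceilingGap (X a q m) α) (αPower a (suc m))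
    remainder m = cong₂ _+_α (remainder-re A (re (S (suc (suc m)))) q d₀ d₁ p w (proj₁ invariant))
                             (remainder-im A (im (S (suc (suc m)))) d₀ d₁ p w (proj₂ invariant))
      where
      d₀ = ceilingGap (X a q m)
      d₁ = ceilingGap (X a q (suc m))
      p = re (αPower a (suc m))
      w = im (αPower a (suc m))
      invariant = partialSum-invariant (suc (suc m))
      remainder-re : ∀ A R q d₀ d₁ p w → R + ((- d₀ + A * d₁) * w + - d₁ * (p + A * w)) ≡ q →
                     R - q ≡ d₁ * p + d₀ * w
      remainder-re A R q d₀ d₁ p w R+T≡q = begin-equality
        R - q                                                 ≡⟨ cong (λ r → R - r) R+T≡q ⟨
        R - (R + ((- d₀ + A * d₁) * w + - d₁ * (p + A * w)))  ≡⟨ solve (A ∷ R ∷ d₀ ∷ d₁ ∷ p ∷ w ∷ []) ℚ-ring ⟩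
        d₁ * p + d₀ * w                                       ∎
      remainder-im : ∀ A I d₀ d₁ p w → I + ((- d₀ + A * d₁) * (p + A * w) + - d₁ * (w + A * (p + A * w))) ≡ 0ℚ →
                     I - 0ℚ ≡ d₁ * w + d₀ * p + A * (d₀ * w)
      remainder-im A I d₀ d₁ p w I+T≡0 = begin-equality
        I - 0ℚ
          ≡⟨ cong (λ r → I - r) I+T≡0 ⟨
        I - (I + ((- d₀ + A * d₁) * (p + A * w) + - d₁ * (w + A * (p + A * w))))
          ≡⟨ solve (A ∷ I ∷ d₀ ∷ d₁ ∷ p ∷ w ∷ []) ℚ-ring ⟩
        d₁ * w + d₀ * p + A * (d₀ * w) ∎

  module _ {a} (1≤a : 1 ℕ.≤ a) where

    private
      A = ℚof a

    small-multiple : ∀ {ε d₀ d₁ m} → 0ℚ < ε → 0ℚ ≤ d₀ → d₀ < 1ℚ → 0ℚ ≤ d₁ → d₁ < 1ℚ → 0ℚ < d₁ + d₀ →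
                     ε * ε + (A + 1ℚ) < ε * ((d₁ + d₀) * ℚof (suc m)) →
                     AbsLt a (mulα a (d₁ + d₀ α) (αPower a (suc m))) ε
    small-multiple {ε} {d₀} {d₁} {m} 0<ε 0≤d₀ d₀<1 0≤d₁ d₁<1 0<d₁+d₀ large =
      AbsLt-intro a {ε} {U} {V} {A + 1ℚ} 0<ε (proj₁ bounds) 0<V (proj₁ N-bounds) (proj₂ N-bounds) (begin-strict
        ε * ε + (A + 1ℚ)               <⟨ large ⟩
        ε * ((d₁ + d₀) * ℚof (suc m))  ≤⟨ *-monoˡ-≤-0≤ 0≤ε (*-monoˡ-≤-0≤ (ℚ.<⇒≤ 0<d₁+d₀) (proj₂ growth)) ⟩
        ε * ((d₁ + d₀) * (p + w))      ≤⟨ *-monoˡ-≤-0≤ 0≤ε (proj₂ (proj₂ bounds)) ⟩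
        ε * (U + U + A * V)            ∎)
      where
      π = αPower a (suc m)
      p = re π
      w = im π
      U = d₁ * p + d₀ * w
      V = d₁ * w + d₀ * p + A * (d₀ * w)
      0≤ε = ℚ.<⇒≤ 0<ε
      growth = αPower-growth 1≤a m
      bounds = product-bounds (1≤ℚof 1≤a) 0≤d₀ 0≤d₁ (proj₁ (αPower-nonNeg a (suc m)))
                                                    (proj₂ (αPower-nonNeg a (suc m)))
      0<V : 0ℚ < V
      0<V = ℚ.<-≤-trans (*-pos 0<d₁+d₀ (ℚ.<-≤-trans (ℚ.positive⁻¹ 1ℚ) (proj₁ growth))) (proj₁ (proj₂ bounds))
      N-bounds : - (A + 1ℚ) ≤ normα a (U + V α) × normα a (U + V α) ≤ A + 1ℚ
      N-bounds = subst (λ N → - (A + 1ℚ) ≤ N × N ≤ A + 1ℚ) (sym (normα-mulα a (d₁ + d₀ α) π))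
                       (±-bounded {A + 1ℚ} {norm A d₁ d₀} {normα a π}
                                  (norm-bounds (0≤ℚof a) 0≤d₀ d₀<1 0≤d₁ d₁<1) (normα-αPower a (suc m)))

    small-gridMultiple : ∀ {D} .{{_ : ℕ.NonZero D}} {ε d₀ d₁ m} → 0ℚ < ε →
                         0ℚ ≤ d₀ → d₀ < 1ℚ → 0ℚ ≤ d₁ → d₁ < 1ℚ → OnGrid D (d₁ + d₀) →
                         (ε * ε + (A + 1ℚ)) * ℚof D < ε * ℚof (suc m) →
                         AbsLt a (mulα a (d₁ + d₀ α) (αPower a (suc m))) ε
    small-gridMultiple {D} {ε} {d₀} {d₁} {m} 0<ε 0≤d₀ d₀<1 0≤d₁ d₁<1 s∈ large =
      by-cases (onGrid-nonNeg s∈ (ℚ.+-mono-≤ 0≤d₁ 0≤d₀))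
      where
      π = αPower a (suc m)
      0<D = 0<ℚof (ℕ.>-nonZero⁻¹ D)
      zero-times : mulα a (0ℚ + 0ℚ α) π ≡ 0ℚ + 0ℚ α
      zero-times = cong₂ _+_α (zero-re (re π) (im π)) (zero-im A (re π) (im π))
        where
        zero-re : ∀ p w → 0ℚ * p + 0ℚ * w ≡ 0ℚ
        zero-re = solve-∀ ℚ-ring
        zero-im : ∀ A p w → 0ℚ * w + 0ℚ * p + A * (0ℚ * w) ≡ 0ℚ
        zero-im = solve-∀ ℚ-ring
      by-cases : d₁ + d₀ ≡ 0ℚ ⊎ 1ℚ ≤ (d₁ + d₀) * ℚof D → AbsLt a (mulα a (d₁ + d₀ α) π) ε
      by-cases (inj₁ d₁+d₀≡0) =
        subst₂ (λ d₁ d₀ → AbsLt a (mulα a (d₁ + d₀ α) π) ε) (sym (proj₁ zeros)) (sym (proj₂ zeros))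
               (subst (λ z → AbsLt a z ε) (sym zero-times) (AbsLt-zero a 0<ε))
        where zeros = nonNeg-+≡0 0≤d₁ 0≤d₀ d₁+d₀≡0
      by-cases (inj₂ 1≤sD) =
        small-multiple {ε} {d₀} {d₁} {m} 0<ε 0≤d₀ d₀<1 0≤d₁ d₁<1 0<s
          (rescale {ε * ε + (A + 1ℚ)} {ε} {d₁ + d₀} {ℚof (suc m)} {ℚof D}
                   0<D (ℚ.<⇒≤ 0<ε) (0≤ℚof (suc m)) 1≤sD large)
        where
        0<s : 0ℚ < d₁ + d₀
        0<s = ℚ.*-cancelʳ-<-nonNeg (ℚof D) {{ℚ.nonNegative (ℚ.<⇒≤ 0<D)}}
                (subst (_< (d₁ + d₀) * ℚof D) (sym (ℚ.*-zeroˡ (ℚof D))) (ℚ.<-≤-trans (ℚ.positive⁻¹ 1ℚ) 1≤sD))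

    partialSums-converge : ∀ q → SeriesConvergesTo a (output a q) q
    partialSums-converge q ε 0<ε = 2 ℕ.+ N , tail-small
      where
      C = (ε * ε + (A + 1ℚ)) * ℚof (↧ₙ q)
      N = proj₁ (archimedean C 0<ε)
      gap-bounds = λ n → ceilingGap-bounds (X a q n)
      gap-onGrid = λ n → onGrid-ceilingGap (proj₁ (window-onGrid a q n))
      tail-small : ∀ n → 2 ℕ.+ N ℕ.≤ n → AbsLt a (subα (partialSum a (output a q) n) (embed q)) ε
      tail-small (suc (suc m)) (s≤s (s≤s N≤m)) =
        subst (λ z → AbsLt a z ε) (sym (remainder a q m))
              (small-gridMultiple {↧ₙ q} {ε} {ceilingGap (X a q m)} {ceilingGap (X a q (suc m))} {m} 0<ε
                 (proj₁ (gap-bounds m)) (proj₂ (gap-bounds m))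
                 (proj₁ (gap-bounds (suc m))) (proj₂ (gap-bounds (suc m)))
                 (onGrid-+ (gap-onGrid (suc m)) (gap-onGrid m)) (proj₂ (archimedean C 0<ε) m N≤m))

open import Data.Nat.Base using (_≤_; _+_)

mainTheorem10 : (a : ℕ) → 1 ≤ a → (q : ℚ) → (- 1ℚ) ℚ.< q → q ℚ.< 1ℚ →
    ((i : ℕ) → Σ ℕ (λ k → k ≤ a × output a q i ≡ + k / 1))
    × SeriesConvergesTo a (output a q) q
    × Σ ℕ (λ p → 1 ≤ p × Σ ℕ (λ M → (i : ℕ) → M ≤ i → output a q (i + p) ≡ output a q i))
mainTheorem10 a 1≤a q -1<q q<1 =
  output-digit 1≤a -1<q q<1 , partialSums-converge 1≤a q , output-eventuallyPeriodic 1≤a -1<q q<1
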